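{- Let $\rho:\mathcal{M}\cong\mathcal{N}$ be any isomorphism. Then there are $n<\omega$ and an isomorphism $\theta:\mathcal{A}_n\cong\mathcal{B}_n$ such that $\rho\geq_T\theta$.
   Context: All structures are relational. $\mathcal{H}$ has universe $H=[\omega]^{<\omega}\cup(\omega\times\{0,1\})$ ($[\omega]^{<\omega}$ the finite subsets of $\omega$, identified with characteristic functions) and binary relations $E_i$ ($i<\omega$), with $E_i(X,Y)$ iff $X,Y$ finite sets and $X\triangle Y=\{i\}$, and $D_i$, with $D_i(X,(i,a))$ iff $X$ is a finite set and $X(i)=a$ (nothing else). Computably composite structure: given a computable structure $\mathcal{S}$ with universe $S$ and a uniformly computable collection $\{\mathcal{C}_x:x\in S\}$ (uniformly computable languages and atomic diagrams) with pairwise disjoint universes $C_x$ disjoint from $S$, $\mathcal{S}[\{\mathcal{C}_x\}]$ has universe $S\cup\bigcup_xC_x$, a new binary relation $\mu=\{(c,x):c\in C_x\}\cup\{(x,x):x\in S\}$, the relations of $\mathcal{S}$ on $S$, the relations of each $\mathcal{C}_x$ on $C_x$, and nothing else. Fix uniformly computable collections $\{\mathcal{A}_i:i<\omega\}$, $\{\mathcal{B}_i:i<\omega\}$ with $\mathcal{A}_i\cong\mathcal{B}_i$. For $z\in H$ define: $\mathcal{M}_{(i,0)}=\mathcal{N}_{(i,0)}=\{(i,0)\}\times\mathcal{A}_{i+1}$; $\mathcal{M}_{(i,1)}=\mathcal{N}_{(i,1)}=\{(i,1)\}\times\mathcal{B}_{i+1}$; for $X\in[\omega]^{<\omega}$,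 $\mathcal{M}_X=\{X\}\times\mathcal{A}_0$ and $\mathcal{N}_X=\{X\}\times\mathcal{B}_0$ if $|X|$ is even, and $\mathcal{M}_X=\{X\}\times\mathcal{B}_0$ and $\mathcal{N}_X=\{X\}\times\mathcal{A}_0$ if $|X|$ is odd ($\{z\}\times\mathcal{C}$ denotes the copy of $\mathcal{C}$ with universe $\{z\}\times C$). Let $\mathcal{M}=\mathcal{H}[\{\mathcal{M}_z:z\in H\}]$ and $\mathcal{N}=\mathcal{H}[\{\mathcal{N}_z:z\in H\}]$. -}

module Defs where

open import Data.Nat using (ℕ; zero; suc; _+_; _*_; _∸_; _^_; _<_; _≡ᵇ_)
open import Data.Nat.DivMod using (_/_; _%_)
open import Data.Bool using (Bool; true; false; if_then_else_; _∧_; T; not)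
open import Data.Fin using (Fin)
open import Data.Vec using (Vec; []; _∷_; lookup)
open import Data.List using (List; []; _∷_; length; map; upTo)
open import Data.Nat.ListAction using (sum)
open import Data.List.Relation.Unary.All using (All)
open import Data.Maybe using (Maybe; just; nothing)
open import Data.Product using (Σ; ∃; _×_; _,_; proj₁; proj₂)
open import Relation.Binary.PropositionalEquality using (_≡_)
open import Function using (_∘_)

data Code : ℕ → Set where
  zer  : ∀ {n} → Code n
  sc   : Code 1
  proj : ∀ {n} → Fin n → Code n
  orc  : Code 1
  comp : ∀ {m n} → Code m → Vec (Code n) m → Code n
  prec : ∀ {n} → Code n → Code (suc (suc n)) → Code (suc n)
  mu   : ∀ {n} → Code (suc n) → Code n

mutual
  data _⊢_∙_⇓_ (g : ℕ → ℕ) : ∀ {n} → Code n → Vec ℕ n → ℕ → Set where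
    ev-zer  : ∀ {n} {xs : Vec ℕ n} → g ⊢ zer ∙ xs ⇓ 0
    ev-sc   : ∀ {x} → g ⊢ sc ∙ (x ∷ []) ⇓ suc x
    ev-proj : ∀ {n} {xs : Vec ℕ n} (i : Fin n) → g ⊢ proj i ∙ xs ⇓ lookup xs i
    ev-orc  : ∀ {x} → g ⊢ orc ∙ (x ∷ []) ⇓ g x
    ev-comp : ∀ {m n} {h : Code m} {fs : Vec (Code n) m} {xs : Vec ℕ n} {ys : Vec ℕ m} {z} →
              g ⊢ fs ∙* xs ⇓* ys → g ⊢ h ∙ ys ⇓ z → g ⊢ comp h fs ∙ xs ⇓ z
    ev-prec0 : ∀ {n} {f : Code n} {h : Code (suc (suc n))} {xs : Vec ℕ n} {z} →
               g ⊢ f ∙ xs ⇓ z → g ⊢ prec f h ∙ (0 ∷ xs) ⇓ z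
    ev-precS : ∀ {n} {f : Code n} {h : Code (suc (suc n))} {xs : Vec ℕ n} {k r z} →
               g ⊢ prec f h ∙ (k ∷ xs) ⇓ r → g ⊢ h ∙ (k ∷ r ∷ xs) ⇓ z →
               g ⊢ prec f h ∙ (suc k ∷ xs) ⇓ z
    ev-mu : ∀ {n} {f : Code (suc n)} {xs : Vec ℕ n} {y} →
            g ⊢ f ∙ (y ∷ xs) ⇓ 0 →
            (∀ z → z < y → Σ ℕ (λ w → g ⊢ f ∙ (z ∷ xs) ⇓ suc w)) →
            g ⊢ mu f ∙ xs ⇓ y

  data _⊢_∙*_⇓*_ (g : ℕ → ℕ) : ∀ {m n} → Vec (Code n) m → Vec ℕ n → Vec ℕ m → Set where
    ev-[] : ∀ {n} {xs : Vec ℕ n} → g ⊢ [] ∙* xs ⇓* []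
    ev-∷  : ∀ {m n} {f : Code n} {fs : Vec (Code n) m} {xs : Vec ℕ n} {y ys} →
            g ⊢ f ∙ xs ⇓ y → g ⊢ fs ∙* xs ⇓* ys → g ⊢ (f ∷ fs) ∙* xs ⇓* (y ∷ ys)

noOracle : ℕ → ℕ
noOracle _ = 0

_≤T_ : (ℕ → ℕ) → (ℕ → ℕ) → Set
f ≤T g = Σ (Code 1) λ e → ∀ x → g ⊢ e ∙ (x ∷ []) ⇓ f x

-- oracle representing a function f defined on the (decidable) set U:
-- value 0 outside U, suc (f x) on U  (Turing equivalent to the graph of f)
graphOn : (ℕ → Bool) → (ℕ → ℕ) → ℕ → ℕ
graphOn U f x = if U x then suc (f x) else 0

b2n : Bool → ℕ
b2n true = 1
b2n false = 0

tri : ℕ → ℕ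
tri zero = zero
tri (suc n) = suc n + tri n

pair : ℕ → ℕ → ℕ
pair x y = tri (x + y) + y

unpair : ℕ → ℕ × ℕ
unpair zero = 0 , 0
unpair (suc c) with unpair c
... | zero , y = suc y , 0
... | suc x , y = x , suc y

listCode : List ℕ → ℕ
listCode [] = 0
listCode (x ∷ xs) = suc (pair x (listCode xs))

-- Language: symbols j with sym j = true, symbol j has arity ar j;
-- rel j t interprets symbol j on tuples t (relevant when length t ≡ ar j).

record Str : Set where
  field
    dom : ℕ → Bool
    sym : ℕ → Bool
    ar  : ℕ → ℕ
    rel : ℕ → List ℕ → Bool
open Str public

record IsIso (A B : Str) (f : ℕ → ℕ) : Set where
  field
    sameLang : ∀ j → sym A j ≡ sym B j
    sameAr   : ∀ j → T (sym A j) → ar A j ≡ ar B j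
    into     : ∀ x → T (dom A x) → T (dom B (f x))
    inj      : ∀ x y → T (dom A x) → T (dom A y) → f x ≡ f y → x ≡ y
    surj     : ∀ y → T (dom B y) → ∃ λ x → T (dom A x) × f x ≡ y
    pres     : ∀ j t → T (sym A j) → length t ≡ ar A j → All (T ∘ dom A) t →
               rel A j t ≡ rel B j (map f t)

record UnifComp (F : ℕ → Str) : Set where
  field
    domC : Σ (Code 2) λ e → ∀ i x →
             noOracle ⊢ e ∙ (i ∷ x ∷ []) ⇓ b2n (dom (F i) x)
    symC : Σ (Code 2) λ e → ∀ i j →
             noOracle ⊢ e ∙ (i ∷ j ∷ []) ⇓ b2n (sym (F i) j)
    arC  : Σ (Code 2) λ e → ∀ i j →
             noOracle ⊢ e ∙ (i ∷ j ∷ []) ⇓ ar (F i) j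
    relC : Σ (Code 3) λ e → ∀ i j t → All (T ∘ dom (F i)) t →
             noOracle ⊢ e ∙ (i ∷ j ∷ listCode t ∷ []) ⇓ b2n (rel (F i) j t)

-- Element codes: unpair c = (0 , s) is the element s of S;
--                unpair c = (suc s , a) is the element a of C_s.
-- Symbol codes:  unpair σ = (0 , 0) is μ;  (1 , j) is symbol j of S;
--                (2 , pair j k) is symbol j (of arity k) of the C_x's.

data Part : Set where
  top : ℕ → Part
  inn : ℕ → ℕ → Part

part : ℕ → Part
part c with unpair c
... | zero , s = top s
... | suc s , a = inn s a

tops : List ℕ → Maybe (List ℕ)
tops [] = just []
tops (c ∷ cs) with part c | tops cs
... | top s | just ss = just (s ∷ ss)
... | _ | _ = nothing

inns : ℕ → List ℕ → Maybe (List ℕ)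
inns x [] = just []
inns x (c ∷ cs) with part c | inns x cs
... | inn s a | just as = if s ≡ᵇ x then just (a ∷ as) else nothing
... | _ | _ = nothing

μRel : List ℕ → Bool
μRel (c ∷ d ∷ []) with part c | part d
... | inn s a | top x = s ≡ᵇ x
... | top s | top x = s ≡ᵇ x
... | _ | _ = false
μRel _ = false

topRel : Str → ℕ → List ℕ → Bool
topRel S j t with tops t
... | just ss = rel S j ss
... | nothing = false

innRel : (ℕ → Str) → ℕ → ℕ → List ℕ → Bool
innRel C j k [] = false
innRel C j k (c ∷ cs) with part c
... | top _ = false
... | inn x _ with inns x (c ∷ cs)
...   | nothing = false
...   | just as = sym (C x) j ∧ (ar (C x) j ≡ᵇ k) ∧ rel (C x) j as

composite : Str → (ℕ → Str) → Str
composite S C = record { dom = d ; sym = sy ; ar = a ; rel = r }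
  where
  d : ℕ → Bool
  d c with part c
  ... | top s = dom S s
  ... | inn s x = dom S s ∧ dom (C s) x
  sy : ℕ → Bool
  sy σ with unpair σ
  ... | 0 , 0 = true
  ... | 1 , j = sym S j
  ... | 2 , _ = true
  ... | _ , _ = false
  a : ℕ → ℕ
  a σ with unpair σ
  ... | 0 , _ = 2
  ... | 1 , j = ar S j
  ... | 2 , jk = proj₂ (unpair jk)
  ... | _ , _ = 0
  r : ℕ → List ℕ → Bool
  r σ t with unpair σ
  ... | 0 , 0 = μRel t
  ... | 1 , j = topRel S j t
  ... | 2 , jk = innRel C (proj₁ (unpair jk)) (proj₂ (unpair jk)) t
  ... | _ , _ = false

-- Finite subsets of ω are coded by their canonical index n = Σ_{i∈X} 2^i.
-- Elements of H are coded by ℕ bijectively: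
--   2n ↦ the finite set with index n;  4i+1 ↦ (i,0);  4i+3 ↦ (i,1).

data HElt : Set where
  fset : ℕ → HElt
  pnt  : ℕ → Bool → HElt   -- (i , a), false = 0, true = 1

decodeH : ℕ → HElt
decodeH h = if h % 2 ≡ᵇ 0 then fset (h / 2)
            else (if h % 4 ≡ᵇ 1 then pnt (h / 4) false else pnt (h / 4) true)

bit : ℕ → ℕ → Bool
bit zero n = n % 2 ≡ᵇ 1
bit (suc i) n = bit i (n / 2)

-- |X| (all elements of X are < its index)
card : ℕ → ℕ
card n = sum (map (λ i → if bit i n then 1 else 0) (upTo n))

evenCard : ℕ → Bool
evenCard n = card n % 2 ≡ᵇ 0

-- X with membership of i toggled, i.e. the Y with X △ Y = {i}
toggle : ℕ → ℕ → ℕ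
toggle i X = if bit i X then X ∸ 2 ^ i else X + 2 ^ i

boolEq : Bool → Bool → Bool
boolEq true b = b
boolEq false b = not b

Erel : ℕ → HElt → HElt → Bool
Erel i (fset X) (fset Y) = Y ≡ᵇ toggle i X
Erel i _ _ = false

Drel : ℕ → HElt → HElt → Bool
Drel i (fset X) (pnt j a) = (i ≡ᵇ j) ∧ boolEq (bit i X) a
Drel i _ _ = false

-- symbol codes of 𝓗: unpair σ = (0 , i) is E_i, (1 , i) is D_i
𝓗 : Str
𝓗 = record { dom = λ _ → true ; sym = sy ; ar = λ _ → 2 ; rel = r }
  where
  sy : ℕ → Bool
  sy σ with unpair σ
  ... | 0 , _ = true
  ... | 1 , _ = true
  ... | _ , _ = false
  r : ℕ → List ℕ → Bool
  r σ (x ∷ y ∷ []) with unpair σ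
  ... | 0 , i = Erel i (decodeH x) (decodeH y)
  ... | 1 , i = Drel i (decodeH x) (decodeH y)
  ... | _ , _ = false
  r σ _ = false

-- The components 𝓜_z, 𝓝_z and the structures 𝓜, 𝓝
-- (the tagging {z} × _ is realised by the composite's element coding)

compM : (ℕ → Str) → (ℕ → Str) → HElt → Str
compM A B (fset X) = if evenCard X then A 0 else B 0
compM A B (pnt i false) = A (suc i)
compM A B (pnt i true) = B (suc i)

compN : (ℕ → Str) → (ℕ → Str) → HElt → Str
compN A B (fset X) = if evenCard X then B 0 else A 0
compN A B (pnt i false) = A (suc i)
compN A B (pnt i true) = B (suc i)

𝓜 : (ℕ → Str) → (ℕ → Str) → Str
𝓜 A B = composite 𝓗 (λ h → compM A B (decodeH h))

𝓝 : (ℕ → Str) → (ℕ → Str) → Str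
𝓝 A B = composite 𝓗 (λ h → compN A B (decodeH h))

-- An isomorphism ρ : 𝓜 ≅ 𝓝 sends the points of H (the only μ-loops) to points of H, and the
-- component over z onto the component over ρ(z); its restriction to a component is read off ρ
-- by unpairing codes, so it is computable from ρ.  Since D₀(∅, (0,0)), ρ(∅) is a finite set Y.
-- If |Y| is even, ρ restricts to 𝓜_∅ = 𝒜₀ ≅ 𝓝_Y = ℬ₀.  Otherwise pick i ∈ Y: D_i(∅, (i,0))
-- forces D_i(Y, ρ(i,0)), so ρ(i,0) = (i,1) and ρ restricts to 𝒜_{i+1} ≅ ℬ_{i+1}.

module Submission where

open import Defs
open import Data.Bool using (Bool; true; false; _∧_; T; if_then_else_)
open import Data.Bool.Properties using (T-∧; T-≡)
open import Data.Empty using (⊥-elim)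
open import Data.Fin using (#_)
open import Data.List using ([]; _∷_; map; length; upTo)
open import Data.List.Properties using (length-map)
import Data.List.Relation.Unary.All as All
open All using (All; []; _∷_)
open import Data.List.Relation.Unary.All.Properties using (map⁺)
open import Data.Maybe using (just)
open import Data.Nat
open import Data.Nat.DivMod
open import Data.Nat.Divisibility using (n∣m*n)
open import Data.Nat.ListAction using (sum)
open import Data.Nat.Properties
open import Data.Product using (Σ; ∃; _×_; _,_; proj₁; proj₂)
open import Data.Sum using (_⊎_; inj₁; inj₂)
open import Data.Unit using (tt)
open import Data.Vec using (Vec; []; _∷_)
open import Function using (_∘_; Equivalence)
open import Relation.Binary.PropositionalEquality as ≡
  using (_≡_; refl; trans; cong; cong₂; subst; subst₂; _≢_)

open Equivalence using (to; from)

unpair-suc-suc : ∀ {c x y} → unpair c ≡ (suc x , y) → unpair (suc c) ≡ (x , suc y)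
unpair-suc-suc e rewrite e = refl

unpair-suc-zero : ∀ {c y} → unpair c ≡ (0 , y) → unpair (suc c) ≡ (suc y , 0)
unpair-suc-zero e rewrite e = refl

suc-pair-suc : ∀ x y → suc (pair (suc x) y) ≡ pair x (suc y)
suc-pair-suc x y rewrite +-suc x y = ≡.sym (+-suc (tri (suc (x + y))) y)

suc-pair-zero : ∀ y → suc (pair 0 y) ≡ pair (suc y) 0
suc-pair-zero y = begin
  suc (tri y + y)       ≡⟨ cong suc (+-comm (tri y) y) ⟩
  tri (suc y)           ≡⟨ cong tri (≡.sym (+-identityʳ (suc y))) ⟩
  tri (suc y + 0)       ≡⟨ ≡.sym (+-identityʳ _) ⟩
  tri (suc y + 0) + 0   ∎
  where open ≡.≡-Reasoning

unpair-pair : ∀ x y → unpair (pair x y) ≡ (x , y)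
unpair-pair x y = along-diagonal (x + y) x y refl
  where
  along-diagonal : ∀ n x y → x + y ≡ n → unpair (pair x y) ≡ (x , y)
  along-diagonal n       zero    zero    _ = refl
  along-diagonal n       x       (suc y) e = subst (λ c → unpair c ≡ (x , suc y)) (suc-pair-suc x y)
    (unpair-suc-suc {pair (suc x) y} (along-diagonal n (suc x) y (trans (≡.sym (+-suc x y)) e)))
  along-diagonal (suc n) (suc x) zero    e = subst (λ c → unpair c ≡ (suc x , 0)) (suc-pair-zero x)
    (unpair-suc-zero {pair 0 x} (along-diagonal n zero x x≡n))
    where x≡n = suc-injective (trans (≡.sym (+-identityʳ (suc x))) e)

pair-unpair : ∀ c → pair (proj₁ (unpair c)) (proj₂ (unpair c)) ≡ c
pair-unpair zero = refl
pair-unpair (suc c) with unpair c | pair-unpair c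
... | zero  , y | e = trans (≡.sym (suc-pair-zero y)) (cong suc e)
... | suc x , y | e = trans (≡.sym (suc-pair-suc x y)) (cong suc e)

pair-injective : ∀ {a b c d} → pair a b ≡ pair c d → a ≡ c × b ≡ d
pair-injective {a} {b} {c} {d} e
  with refl ← trans (≡.sym (unpair-pair a b)) (trans (cong unpair e) (unpair-pair c d)) = refl , refl

proj₂-unpair : ∀ {c} x y → c ≡ pair x y → proj₂ (unpair c) ≡ y
proj₂-unpair x y e = cong proj₂ (trans (cong unpair e) (unpair-pair x y))

pair-monoʳ-< : ∀ x {y z} → y < z → pair x y < pair x z
pair-monoʳ-< x {y} {suc z} (s≤s y≤z) = begin-strict
  pair x y               ≤⟨ +-mono-≤ (tri-mono (m≤n⇒m≤1+n (+-monoʳ-≤ x y≤z))) y≤z ⟩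
  pair (suc x) z         <⟨ n<1+n _ ⟩
  suc (pair (suc x) z)   ≡⟨ suc-pair-suc x z ⟩
  pair x (suc z)         ∎
  where
  open ≤-Reasoning
  tri-mono : ∀ {m n} → m ≤ n → tri m ≤ tri n
  tri-mono z≤n = z≤n
  tri-mono (s≤s m≤n) = s≤s (+-mono-≤ m≤n (tri-mono m≤n))

≤-pair : ∀ x y → y ≤ pair x y
≤-pair x y = m≤n+m y (tri (x + y))

comp₁ : ∀ {n} → Code 1 → Code n → Code n
comp₁ h f = comp h (f ∷ [])

comp₂ : ∀ {n} → Code 2 → Code n → Code n → Code n
comp₂ h f f′ = comp h (f ∷ f′ ∷ [])

constC : ℕ → ∀ {n} → Code n
constC zero    = zer
constC (suc k) = comp₁ sc (constC k)

plusC : Code 2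
plusC = prec (proj (# 0)) (comp₁ sc (proj (# 1)))

triC : Code 1
triC = prec zer (comp₂ plusC (comp₁ sc (proj (# 0))) (proj (# 1)))

pairC : Code 2
pairC = comp₂ plusC (comp₁ triC plusC) (proj (# 1))

predC : Code 1
predC = prec zer (proj (# 0))

flipMonusC : Code 2
flipMonusC = prec (proj (# 0)) (comp₁ predC (proj (# 1)))

monusC : Code 2
monusC = comp₂ flipMonusC (proj (# 1)) (proj (# 0))

module _ {g : ℕ → ℕ} where

  ⇓-comp₁ : ∀ {n} {h : Code 1} {f : Code n} {xs y z} →
            g ⊢ f ∙ xs ⇓ y → g ⊢ h ∙ (y ∷ []) ⇓ z → g ⊢ comp₁ h f ∙ xs ⇓ z
  ⇓-comp₁ f⇓ h⇓ = ev-comp (ev-∷ f⇓ ev-[]) h⇓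

  ⇓-comp₂ : ∀ {n} {h : Code 2} {f f′ : Code n} {xs y y′ z} →
            g ⊢ f ∙ xs ⇓ y → g ⊢ f′ ∙ xs ⇓ y′ → g ⊢ h ∙ (y ∷ y′ ∷ []) ⇓ z →
            g ⊢ comp₂ h f f′ ∙ xs ⇓ z
  ⇓-comp₂ f⇓ f′⇓ h⇓ = ev-comp (ev-∷ f⇓ (ev-∷ f′⇓ ev-[])) h⇓

  ⇓-const : ∀ k {n} {xs : Vec ℕ n} → g ⊢ constC k ∙ xs ⇓ k
  ⇓-const zero    = ev-zer
  ⇓-const (suc k) = ⇓-comp₁ (⇓-const k) ev-sc

  ⇓-plus : ∀ a b → g ⊢ plusC ∙ (a ∷ b ∷ []) ⇓ (a + b)
  ⇓-plus zero    b = ev-prec0 (ev-proj _)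
  ⇓-plus (suc a) b = ev-precS (⇓-plus a b) (⇓-comp₁ (ev-proj _) ev-sc)

  ⇓-tri : ∀ a → g ⊢ triC ∙ (a ∷ []) ⇓ tri a
  ⇓-tri zero    = ev-prec0 ev-zer
  ⇓-tri (suc a) =
    ev-precS (⇓-tri a) (⇓-comp₂ (⇓-comp₁ (ev-proj _) ev-sc) (ev-proj _) (⇓-plus (suc a) (tri a)))

  ⇓-pair : ∀ a b → g ⊢ pairC ∙ (a ∷ b ∷ []) ⇓ pair a b
  ⇓-pair a b = ⇓-comp₂ (⇓-comp₁ (⇓-plus a b) (⇓-tri (a + b))) (ev-proj _) (⇓-plus (tri (a + b)) b)

  ⇓-pred : ∀ a → g ⊢ predC ∙ (a ∷ []) ⇓ pred a
  ⇓-pred zero    = ev-prec0 ev-zer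
  ⇓-pred (suc a) = ev-precS (⇓-pred a) (ev-proj _)

  ⇓-flipMonus : ∀ b a → g ⊢ flipMonusC ∙ (b ∷ a ∷ []) ⇓ (a ∸ b)
  ⇓-flipMonus zero    a = ev-prec0 (ev-proj _)
  ⇓-flipMonus (suc b) a = subst (g ⊢ flipMonusC ∙ (suc b ∷ a ∷ []) ⇓_) (pred[m∸n]≡m∸[1+n] a b)
    (ev-precS (⇓-flipMonus b a) (⇓-comp₁ (ev-proj _) (⇓-pred (a ∸ b))))

  ⇓-monus : ∀ a b → g ⊢ monusC ∙ (a ∷ b ∷ []) ⇓ (a ∸ b)
  ⇓-monus a b = ⇓-comp₂ (ev-proj _) (ev-proj _) (⇓-flipMonus b a)

  ⇓-mu : ∀ {n} {f : Code (suc n)} {xs : Vec ℕ n} (F : ℕ → ℕ) {a} →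
         (∀ b → g ⊢ f ∙ (b ∷ xs) ⇓ F b) → F a ≡ 0 → (∀ b → b < a → 0 < F b) →
         g ⊢ mu f ∙ xs ⇓ a
  ⇓-mu {f = f} {xs} F f⇓ Fa≡0 F>0 = ev-mu (subst (g ⊢ f ∙ _ ⇓_) Fa≡0 (f⇓ _)) below
    where
    below : ∀ b → b < _ → Σ ℕ λ w → g ⊢ f ∙ (b ∷ xs) ⇓ suc w
    below b b<a = pred (F b) , subst (g ⊢ f ∙ (b ∷ xs) ⇓_) (≡.sym suc[pred[Fb]]≡Fb) (f⇓ b)
      where suc[pred[Fb]]≡Fb = suc-pred (F b) {{>-nonZero (F>0 b b<a)}}

module PairDecoding (S T : ℕ) where

  queryC : Code 1
  queryC = comp₁ orc (comp₂ pairC (constC S) (proj (# 0)))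

  excessC : Code 2
  excessC = comp₂ monusC (comp₁ queryC (proj (# 1)))
                         (comp₁ sc (comp₂ pairC (constC T) (proj (# 0))))

  searchC : Code 1
  searchC = mu excessC

  -- When the query m = g (pair S x) is suc (pair T v), the least a with m ≤ suc (pair T a)
  -- is v and m ∸ (m ∸ suc v) = suc v; when m = 0 the output is 0.
  decodeC : Code 1
  decodeC = comp₂ monusC queryC (comp₂ monusC queryC (comp₁ sc searchC))

  module _ {g : ℕ → ℕ} where

    ⇓-query : ∀ x → g ⊢ queryC ∙ (x ∷ []) ⇓ g (pair S x)
    ⇓-query x = ⇓-comp₁ (⇓-comp₂ (⇓-const S) (ev-proj _) (⇓-pair S x)) ev-orc

    ⇓-decode : ∀ {x m} a → g (pair S x) ≡ m → m ∸ suc (pair T a) ≡ 0 →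
               (∀ b → b < a → 0 < m ∸ suc (pair T b)) →
               g ⊢ decodeC ∙ (x ∷ []) ⇓ (m ∸ (m ∸ suc a))
    ⇓-decode {x} {m} a refl zero-at-a positive-below =
      ⇓-comp₂ (⇓-query x)
              (⇓-comp₂ (⇓-query x) (⇓-comp₁ search ev-sc) (⇓-monus m (suc a)))
              (⇓-monus m _)
      where
      ⇓-excess : ∀ b → g ⊢ excessC ∙ (b ∷ x ∷ []) ⇓ (m ∸ suc (pair T b))
      ⇓-excess b = ⇓-comp₂ (⇓-comp₁ (ev-proj _) (⇓-query x))
                       (⇓-comp₁ (⇓-comp₂ (⇓-const T) (ev-proj _) (⇓-pair T b)) ev-sc) (⇓-monus m _)
      search : g ⊢ searchC ∙ (x ∷ []) ⇓ a
      search = ⇓-mu (λ b → m ∸ suc (pair T b)) ⇓-excess zero-at-a positive-below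

graphOn-pair-≤T : ∀ {g} (U : ℕ → Bool) (f : ℕ → ℕ) S T →
                  (∀ x → g (pair S x) ≡ graphOn U (pair T ∘ f) x) → graphOn U f ≤T g
graphOn-pair-≤T {g} U f S T oracle = decodeC , decodes
  where
  open PairDecoding S T
  decodes : ∀ x → g ⊢ decodeC ∙ (x ∷ []) ⇓ graphOn U f x
  decodes x with U x | oracle x
  ... | false | m≡0 = ⇓-decode 0 m≡0 refl (λ _ ())
  ... | true  | m≡ = subst (g ⊢ decodeC ∙ (x ∷ []) ⇓_) (m∸[m∸n]≡n (s≤s (≤-pair T (f x))))
    (⇓-decode (f x) m≡ (n∸n≡0 (pair T (f x)))
      (λ b b<fx → m<n⇒0<n∸m (s≤s (pair-monoʳ-< T b<fx))))

partOf : ℕ → ℕ → Part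
partOf zero    a = top a
partOf (suc s) a = inn s a

part-pair : ∀ i a → part (pair i a) ≡ partOf i a
part-pair i a rewrite unpair-pair i a with i
... | zero  = refl
... | suc _ = refl

data PartView : ℕ → Set where
  top : ∀ s → PartView (pair 0 s)
  inn : ∀ s a → PartView (pair (suc s) a)

partView : ∀ c → PartView c
partView c with unpair c | pair-unpair c
... | zero  , s | refl = top s
... | suc s , a | refl = inn s a

μPart : Part → Part → Bool
μPart (inn s _) (top x) = s ≡ᵇ x
μPart (top s)   (top x) = s ≡ᵇ x
μPart _         _       = false

μRel≡μPart : ∀ c d → μRel (c ∷ d ∷ []) ≡ μPart (part c) (part d)
μRel≡μPart c d with part c | part d
... | top _   | top _   = refl
... | top _   | inn _ _ = refl
... | inn _ _ | top _   = refl
... | inn _ _ | inn _ _ = refl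

μRel-pair : ∀ i a j b → μRel (pair i a ∷ pair j b ∷ []) ≡ μPart (partOf i a) (partOf j b)
μRel-pair i a j b =
  trans (μRel≡μPart (pair i a) (pair j b)) (cong₂ μPart (part-pair i a) (part-pair j b))

μ-top : ∀ s → T (μRel (pair 0 s ∷ pair 0 s ∷ []))
μ-top s = subst T (≡.sym (μRel-pair 0 s 0 s)) (≡⇒≡ᵇ s s refl)

μ-inn : ∀ s a → T (μRel (pair (suc s) a ∷ pair 0 s ∷ []))
μ-inn s a = subst T (≡.sym (μRel-pair (suc s) a 0 s)) (≡⇒≡ᵇ s s refl)

μ-loop⇒top : ∀ c → T (μRel (c ∷ c ∷ [])) → ∃ λ s → c ≡ pair 0 s
μ-loop⇒top c μcc with partView c
... | top s   = s , refl
... | inn s a = ⊥-elim (subst T (μRel-pair (suc s) a (suc s) a) μcc)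

μ-over : ∀ c t → T (μRel (c ∷ pair 0 t ∷ [])) → c ≡ pair 0 t ⊎ ∃ λ a → c ≡ pair (suc t) a
μ-over c t μct with partView c
... | top s   = inj₁ (cong (pair 0) (≡ᵇ⇒≡ s t (subst T (μRel-pair 0 s 0 t) μct)))
... | inn s a =
  inj₂ (a , cong (λ s → pair (suc s) a) (≡ᵇ⇒≡ s t (subst T (μRel-pair (suc s) a 0 t) μct)))

≡ᵇ-refl : ∀ n → (n ≡ᵇ n) ≡ true
≡ᵇ-refl n = to T-≡ (≡⇒≡ᵇ n n refl)

tops-top : ∀ l → tops (map (pair 0) l) ≡ just l
tops-top []      = refl
tops-top (s ∷ l) rewrite part-pair 0 s | tops-top l = refl

inns-inn : ∀ s l → inns s (map (pair (suc s)) l) ≡ just l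
inns-inn s []      = refl
inns-inn s (a ∷ l) rewrite part-pair (suc s) a | inns-inn s l | ≡ᵇ-refl s = refl

μSym : ℕ
μSym = pair 0 0

module Composite (S : Str) (C : ℕ → Str) where

  private
    K : Str
    K = composite S C

  baseSym : ℕ → ℕ
  baseSym j = pair 1 j

  fibreSym : ℕ → ℕ → ℕ
  fibreSym j k = pair 2 (pair j k)

  dom-top : ∀ s → dom K (pair 0 s) ≡ dom S s
  dom-top s rewrite unpair-pair 0 s = refl

  dom-inn : ∀ s x → dom K (pair (suc s) x) ≡ dom S s ∧ dom (C s) x
  dom-inn s x rewrite unpair-pair (suc s) x = refl

  sym-baseSym : ∀ j → sym K (baseSym j) ≡ sym S j
  sym-baseSym j rewrite unpair-pair 1 j = refl

  ar-baseSym : ∀ j → ar K (baseSym j) ≡ ar S j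
  ar-baseSym j rewrite unpair-pair 1 j = refl

  rel-baseSym : ∀ j l → rel K (baseSym j) (map (pair 0) l) ≡ rel S j l
  rel-baseSym j l rewrite unpair-pair 1 j | tops-top l = refl

  sym-fibreSym : ∀ j k → T (sym K (fibreSym j k))
  sym-fibreSym j k rewrite unpair-pair 2 (pair j k) = tt

  ar-fibreSym : ∀ j k → ar K (fibreSym j k) ≡ k
  ar-fibreSym j k rewrite unpair-pair 2 (pair j k) | unpair-pair j k = refl

  rel-fibreSym : ∀ {s j k} a l → T (sym (C s) j) → ar (C s) j ≡ k →
                 rel K (fibreSym j k) (map (pair (suc s)) (a ∷ l)) ≡ rel (C s) j (a ∷ l)
  rel-fibreSym {s} {j} {k} a l j∈C refl
    rewrite unpair-pair 2 (pair j k) | unpair-pair j k | part-pair (suc s) a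
          | inns-inn s (a ∷ l) | to T-≡ j∈C | ≡ᵇ-refl k = refl

module CompositeIso {S S′ : Str} {C D : ℕ → Str} {ρ : ℕ → ℕ}
                    (R : IsIso (composite S C) (composite S′ D) ρ) where

  private
    K K′ : Str
    K  = composite S C
    K′ = composite S′ D
    module K  = Composite S C
    module K′ = Composite S′ D
  open IsIso R

  base : ℕ → ℕ
  base s = proj₂ (unpair (ρ (pair 0 s)))

  fibre : ℕ → ℕ → ℕ
  fibre s x = proj₂ (unpair (ρ (pair (suc s) x)))

  private
    top∈K : ∀ {s} → T (dom S s) → T (dom K (pair 0 s))
    top∈K {s} = subst T (≡.sym (K.dom-top s))

    inn∈K : ∀ {s x} → T (dom S s) → T (dom (C s) x) → T (dom K (pair (suc s) x))
    inn∈K {s} {x} s∈S x∈Cs = subst T (≡.sym (K.dom-inn s x)) (from T-∧ (s∈S , x∈Cs))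

  μ-preserved : ∀ {c d} → T (dom K c) → T (dom K d) → μRel (c ∷ d ∷ []) ≡ μRel (ρ c ∷ ρ d ∷ [])
  μ-preserved {c} {d} c∈K d∈K = pres μSym (c ∷ d ∷ []) tt refl (c∈K ∷ d∈K ∷ [])

  ρ-top : ∀ {s} → T (dom S s) → ρ (pair 0 s) ≡ pair 0 (base s)
  ρ-top {s} s∈S with μ-loop⇒top (ρ (pair 0 s)) (subst T (μ-preserved c∈K c∈K) (μ-top s))
    where c∈K = top∈K s∈S
  ... | t , ρs≡t = trans ρs≡t (cong (pair 0) (≡.sym (proj₂-unpair 0 t ρs≡t)))

  base∈S′ : ∀ {s} → T (dom S s) → T (dom S′ (base s))
  base∈S′ {s} s∈S = subst T ρs∈K′ (into (pair 0 s) (top∈K s∈S))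
    where ρs∈K′ = trans (cong (dom K′) (ρ-top s∈S)) (K′.dom-top (base s))

  map-ρ-top : ∀ {l} → All (T ∘ dom S) l → map ρ (map (pair 0) l) ≡ map (pair 0) (map base l)
  map-ρ-top []             = refl
  map-ρ-top (s∈S ∷ l⊆S) = cong₂ _∷_ (ρ-top s∈S) (map-ρ-top l⊆S)

  base-pres : ∀ j l → T (sym S j) → length l ≡ ar S j → All (T ∘ dom S) l →
              rel S j l ≡ rel S′ j (map base l)
  base-pres j l j∈S len l⊆S = begin
    rel S j l                                  ≡⟨ K.rel-baseSym j l ⟨
    rel K σ (map (pair 0) l)                   ≡⟨ pres σ _ σ∈K len′ (map⁺ (All.map top∈K l⊆S)) ⟩
    rel K′ σ (map ρ (map (pair 0) l))          ≡⟨ cong (rel K′ σ) (map-ρ-top l⊆S) ⟩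
    rel K′ σ (map (pair 0) (map base l))       ≡⟨ K′.rel-baseSym j (map base l) ⟩
    rel S′ j (map base l)                      ∎
    where
    open ≡.≡-Reasoning
    σ = K.baseSym j
    σ∈K = subst T (≡.sym (K.sym-baseSym j)) j∈S
    len′ = trans (length-map _ l) (trans len (≡.sym (K.ar-baseSym j)))

  ρ-inn : ∀ {s x} → T (dom S s) → T (dom (C s) x) →
          ρ (pair (suc s) x) ≡ pair (suc (base s)) (fibre s x)
  ρ-inn {s} {x} s∈S x∈Cs with μ-over (ρ (pair (suc s) x)) (base s) μ-image
    where
    μ-image : T (μRel (ρ (pair (suc s) x) ∷ pair 0 (base s) ∷ []))
    μ-image = subst T (trans (μ-preserved (inn∈K s∈S x∈Cs) (top∈K s∈S))
                             (cong (λ c → μRel (ρ (pair (suc s) x) ∷ c ∷ [])) (ρ-top s∈S)))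
                      (μ-inn s x)
  ... | inj₂ (a , ρx≡a) =
    trans ρx≡a (cong (pair (suc (base s))) (≡.sym (proj₂-unpair (suc (base s)) a ρx≡a)))
  ... | inj₁ ρx≡top with () ← proj₁ (pair-injective {suc s} {x} {0} {s}
        (inj _ _ (inn∈K s∈S x∈Cs) (top∈K s∈S) (trans ρx≡top (≡.sym (ρ-top s∈S)))))

  fibre-surjective : ∀ {s y} → T (dom S s) → T (dom (D (base s)) y) →
                     ∃ λ x → T (dom (C s) x) × fibre s x ≡ y
  fibre-surjective {s} {y} s∈S y∈D with surj (pair (suc (base s)) y) y∈K′
    where
    y∈K′ = subst T (≡.sym (K′.dom-inn (base s) y)) (from T-∧ (base∈S′ s∈S , y∈D))
  ... | z , z∈K , ρz≡y with μ-over z s μ-preimage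
    where
    μ-preimage : T (μRel (z ∷ pair 0 s ∷ []))
    μ-preimage = subst T (≡.sym (trans (μ-preserved z∈K (top∈K s∈S))
                   (cong₂ (λ c d → μRel (c ∷ d ∷ [])) ρz≡y (ρ-top s∈S))))
                   (μ-inn (base s) y)
  ... | inj₂ (x , refl) = x , proj₂ (to T-∧ (subst T (K.dom-inn s x) z∈K)) ,
                          proj₂-unpair (suc (base s)) y ρz≡y
  ... | inj₁ refl with () ← proj₁ (pair-injective {0} {base s} {suc (base s)} {y}
                              (trans (≡.sym (ρ-top s∈S)) ρz≡y))

  fibre-injective : ∀ {s x y} → T (dom S s) → T (dom (C s) x) → T (dom (C s) y) →
                    fibre s x ≡ fibre s y → x ≡ y
  fibre-injective {s} {x} {y} s∈S x∈Cs y∈Cs θx≡θy =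
    proj₂ (pair-injective {suc s} {x} {suc s} {y} (inj _ _ (inn∈K s∈S x∈Cs) (inn∈K s∈S y∈Cs) ρx≡ρy))
    where
    open ≡.≡-Reasoning
    ρx≡ρy : ρ (pair (suc s) x) ≡ ρ (pair (suc s) y)
    ρx≡ρy = begin
      ρ (pair (suc s) x)               ≡⟨ ρ-inn s∈S x∈Cs ⟩
      pair (suc (base s)) (fibre s x)  ≡⟨ cong (pair (suc (base s))) θx≡θy ⟩
      pair (suc (base s)) (fibre s y)  ≡⟨ ρ-inn s∈S y∈Cs ⟨
      ρ (pair (suc s) y)               ∎

  fibre∈D : ∀ {s x} → T (dom S s) → T (dom (C s) x) → T (dom (D (base s)) (fibre s x))
  fibre∈D {s} {x} s∈S x∈Cs = proj₂ (to T-∧ (subst T ρx∈K′ (into _ (inn∈K s∈S x∈Cs))))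
    where ρx∈K′ = trans (cong (dom K′) (ρ-inn s∈S x∈Cs)) (K′.dom-inn (base s) (fibre s x))

  map-ρ-inn : ∀ {s} → T (dom S s) → ∀ {l} → All (T ∘ dom (C s)) l →
              map ρ (map (pair (suc s)) l) ≡ map (pair (suc (base s))) (map (fibre s) l)
  map-ρ-inn s∈S []             = refl
  map-ρ-inn s∈S (x∈Cs ∷ l⊆Cs) = cong₂ _∷_ (ρ-inn s∈S x∈Cs) (map-ρ-inn s∈S l⊆Cs)

  fibre-pres : ∀ {s j} → T (dom S s) → T (sym (C s) j) → T (sym (D (base s)) j) →
               ar (C s) j ≡ ar (D (base s)) j → ∀ a l → length (a ∷ l) ≡ ar (C s) j →
               All (T ∘ dom (C s)) (a ∷ l) →
               rel (C s) j (a ∷ l) ≡ rel (D (base s)) j (map (fibre s) (a ∷ l))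
  fibre-pres {s} {j} s∈S j∈C j∈D ar≡ a l len al = begin
    rel (C s) j (a ∷ l)                            ≡⟨ K.rel-fibreSym a l j∈C refl ⟨
    rel K σ (map (pair (suc s)) (a ∷ l))           ≡⟨ pres σ _ (K.sym-fibreSym j k) len′ inns∈K ⟩
    rel K′ σ (map ρ (map (pair (suc s)) (a ∷ l)))  ≡⟨ cong (rel K′ σ) (map-ρ-inn s∈S al) ⟩
    rel K′ σ (map (pair (suc t)) (map θ (a ∷ l)))  ≡⟨ K′.rel-fibreSym _ _ j∈D (≡.sym ar≡) ⟩
    rel (D t) j (map θ (a ∷ l))                    ∎
    where
    open ≡.≡-Reasoning
    t = base s
    θ = fibre s
    k = ar (C s) j
    σ = K.fibreSym j k
    len′ = trans (length-map _ (a ∷ l)) (trans len (≡.sym (K.ar-fibreSym j k)))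
    inns∈K = map⁺ (All.map (inn∈K s∈S) al)

  -- I is used only for the language and the nullary relations of the fibres, which ρ does not see.
  fibre-iso : ∀ {s f} → T (dom S s) → IsIso (C s) (D (base s)) f → IsIso (C s) (D (base s)) (fibre s)
  fibre-iso {s} s∈S I = record
    { sameLang = I.sameLang
    ; sameAr   = I.sameAr
    ; into     = λ _ → fibre∈D s∈S
    ; inj      = λ _ _ → fibre-injective s∈S
    ; surj     = λ _ → fibre-surjective s∈S
    ; pres     = fibre-pres′
    }
    where
    module I = IsIso I
    fibre-pres′ : ∀ j l → T (sym (C s) j) → length l ≡ ar (C s) j → All (T ∘ dom (C s)) l →
                  rel (C s) j l ≡ rel (D (base s)) j (map (fibre s) l)
    fibre-pres′ j []      j∈C len al = I.pres j [] j∈C len al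
    fibre-pres′ j (a ∷ l) j∈C len al =
      fibre-pres s∈S j∈C (subst T (I.sameLang j) j∈C) (I.sameAr j j∈C) a l len al

  fibre-≤T : ∀ {s} → T (dom S s) → graphOn (dom (C s)) (fibre s) ≤T graphOn (dom K) ρ
  fibre-≤T {s} s∈S = graphOn-pair-≤T (dom (C s)) (fibre s) (suc s) (suc (base s)) query
    where
    query : ∀ x → graphOn (dom K) ρ (pair (suc s) x) ≡
                  graphOn (dom (C s)) (pair (suc (base s)) ∘ fibre s) x
    query x rewrite K.dom-inn s x | to T-≡ s∈S with dom (C s) x in x∈Cs
    ... | false = refl
    ... | true  = cong suc (ρ-inn s∈S (from T-≡ x∈Cs))

[1+i*4]%2≡1 : ∀ i → suc (i * 4) % 2 ≡ 1
[1+i*4]%2≡1 i = trans (cong (λ k → suc k % 2) (≡.sym (*-assoc i 2 2))) ([m+kn]%n≡m%n 1 (i * 2) 2)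

[1+i*4]/4≡i : ∀ i → suc (i * 4) / 4 ≡ i
[1+i*4]/4≡i i = trans (+-distrib-/-∣ʳ 1 {d = 4} (n∣m*n i)) (m*n/n≡m i 4)

decodeH-point : ∀ i → decodeH (suc (i * 4)) ≡ pnt i false
decodeH-point i =
  unfolded _ ([1+i*4]%2≡1 i) _ ([m+kn]%n≡m%n 1 i 4) _ ([1+i*4]/4≡i i)
  where
  unfolded : ∀ r₂ → r₂ ≡ 1 → ∀ r₄ → r₄ ≡ 1 → ∀ q → q ≡ i →
             (if r₂ ≡ᵇ 0 then fset (suc (i * 4) / 2) else (if r₄ ≡ᵇ 1 then pnt q false else pnt q true))
             ≡ pnt i false
  unfolded _ refl _ refl _ refl = refl

bit-empty : ∀ i → bit i 0 ≡ false
bit-empty zero    = refl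
bit-empty (suc i) = bit-empty i

count≢0⇒member : ∀ X l → sum (map (λ i → if bit i X then 1 else 0) l) ≢ 0 → ∃ λ i → T (bit i X)
count≢0⇒member X []      count≢0 = ⊥-elim (count≢0 refl)
count≢0⇒member X (i ∷ l) count≢0 with bit i X in i∈X
... | true  = i , from T-≡ i∈X
... | false = count≢0⇒member X l count≢0

odd-card⇒member : ∀ X → evenCard X ≡ false → ∃ λ i → T (bit i X)
odd-card⇒member X odd = count≢0⇒member X (upTo X) card≢0
  where
  card≢0 : card X ≢ 0
  card≢0 card≡0 with () ← trans (≡.sym odd) (cong (λ c → c % 2 ≡ᵇ 0) card≡0)

boolEq⇒≡ : ∀ b a → T (boolEq b a) → a ≡ b
boolEq⇒≡ true  true  _ = refl
boolEq⇒≡ false false _ = refl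

Drel-fset : ∀ {i h h′} → T (Drel i h h′) → ∃ λ X → h ≡ fset X
Drel-fset {h = fset X} {pnt _ _} _ = X , refl

Drel-point : ∀ {i X h} → T (Drel i (fset X) h) → h ≡ pnt i (bit i X)
Drel-point {i} {X} {pnt j a} D with i≡j , a≡X[i] ← to T-∧ D =
  cong₂ pnt (≡.sym (≡ᵇ⇒≡ i j i≡j)) (boolEq⇒≡ (bit i X) a a≡X[i])

Drel-∅ : ∀ i → T (Drel i (fset 0) (pnt i false))
Drel-∅ i = from T-∧ (≡⇒≡ᵇ i i refl , subst (λ b → T (boolEq b false)) (≡.sym (bit-empty i)) tt)

Dsym : ℕ → ℕ
Dsym i = pair 1 i

sym-𝓗-Dsym : ∀ i → T (sym 𝓗 (Dsym i))
sym-𝓗-Dsym i rewrite unpair-pair 1 i = tt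

rel-𝓗-Dsym : ∀ i a b → rel 𝓗 (Dsym i) (a ∷ b ∷ []) ≡ Drel i (decodeH a) (decodeH b)
rel-𝓗-Dsym i a b rewrite unpair-pair 1 i = refl

Drel-preserved : ∀ {C C′ ρ} (R : IsIso (composite 𝓗 C) (composite 𝓗 C′) ρ) →
                 let open CompositeIso R in ∀ i a b →
                 T (Drel i (decodeH a) (decodeH b)) → T (Drel i (decodeH (base a)) (decodeH (base b)))
Drel-preserved R i a b = subst T (begin
  Drel i (decodeH a) (decodeH b)                ≡⟨ rel-𝓗-Dsym i a b ⟨
  rel 𝓗 (Dsym i) (a ∷ b ∷ [])                   ≡⟨ base-pres (Dsym i) _ (sym-𝓗-Dsym i) refl (tt ∷ tt ∷ []) ⟩
  rel 𝓗 (Dsym i) (base a ∷ base b ∷ [])         ≡⟨ rel-𝓗-Dsym i (base a) (base b) ⟩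
  Drel i (decodeH (base a)) (decodeH (base b))  ∎)
  where
  open CompositeIso R
  open ≡.≡-Reasoning

module Witnesses (A B : ℕ → Str) (isos : (i : ℕ) → Σ (ℕ → ℕ) (IsIso (A i) (B i)))
               {ρ : ℕ → ℕ} (R : IsIso (𝓜 A B) (𝓝 A B) ρ) where

  open CompositeIso R public using (base)
  open CompositeIso R using (fibre; fibre-iso; fibre-≤T)

  Witness : Set
  Witness = Σ ℕ λ n → Σ (ℕ → ℕ) λ θ →
    IsIso (A n) (B n) θ × (graphOn (dom (A n)) θ ≤T graphOn (dom (𝓜 A B)) ρ)

  fibre-witness : ∀ n s → compM A B (decodeH s) ≡ A n → compN A B (decodeH (base s)) ≡ B n → Witness
  fibre-witness n s Ms≡An Nρs≡Bn =
    n , fibre s , subst₂ P Ms≡An Nρs≡Bn (fibre-iso {s} tt fibres-iso , fibre-≤T {s} tt)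
    where
    P : Str → Str → Set
    P X Y = IsIso X Y (fibre s) × (graphOn (dom X) (fibre s) ≤T graphOn (dom (𝓜 A B)) ρ)
    fibres-iso : IsIso (compM A B (decodeH s)) (compN A B (decodeH (base s))) (proj₁ (isos n))
    fibres-iso = subst₂ (λ X Y → IsIso X Y (proj₁ (isos n))) (≡.sym Ms≡An) (≡.sym Nρs≡Bn)
                        (proj₂ (isos n))

  image-of-∅ : ∃ λ Y → decodeH (base 0) ≡ fset Y
  image-of-∅ = Drel-fset (Drel-preserved R 0 0 1 tt)

  image-of-point : ∀ {Y i} → decodeH (base 0) ≡ fset Y → T (bit i Y) →
                   decodeH (base (suc (i * 4))) ≡ pnt i true
  image-of-point {Y} {i} ρ∅≡Y i∈Y = trans (Drel-point D-image) (cong (pnt i) (to T-≡ i∈Y))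
    where
    D-image : T (Drel i (fset Y) (decodeH (base (suc (i * 4)))))
    D-image = subst (λ h → T (Drel i h (decodeH (base (suc (i * 4)))))) ρ∅≡Y
      (Drel-preserved R i 0 (suc (i * 4)) (subst (T ∘ Drel i (fset 0)) (≡.sym (decodeH-point i)) (Drel-∅ i)))

lemma3p16 : (A B : ℕ → Str) → UnifComp A → UnifComp B →
    ((i : ℕ) → Σ (ℕ → ℕ) (IsIso (A i) (B i))) →
    (ρ : ℕ → ℕ) → IsIso (𝓜 A B) (𝓝 A B) ρ →
    Σ ℕ λ n → Σ (ℕ → ℕ) λ θ →
      IsIso (A n) (B n) θ × (graphOn (dom (A n)) θ ≤T graphOn (dom (𝓜 A B)) ρ)
lemma3p16 A B _ _ isos ρ R = from-image image-of-∅
  where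
  open Witnesses A B isos R
  from-image : (∃ λ Y → decodeH (base 0) ≡ fset Y) → Witness
  from-image (Y , ρ∅≡Y) with evenCard Y in parity
  ... | true  = fibre-witness 0 0 refl
                  (trans (cong (compN A B) ρ∅≡Y) (cong (λ b → if b then B 0 else A 0) parity))
  ... | false = let i , i∈Y = odd-card⇒member Y parity in
                fibre-witness (suc i) (suc (i * 4))
                  (cong (compM A B) (decodeH-point i)) (cong (compN A B) (image-of-point ρ∅≡Y i∈Y))
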